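{- Let $\mathcal A$ be any one of the second-order cellular automata $\mathcal R_1,\mathcal R_2,\mathcal R_3,\mathcal R_3'$ defined in the context, with initial configuration having state $(1,0)$ at cell $(0,0)$ and $(0,0)$ elsewhere; let $R_1(n)$, $R_2(n)$ be the numbers of cells with value $1$, respectively $2$, after $n$ steps. Then for all integers $n\ge 0$: $$R_1(2n+1)=4R_1(n),\qquad R_1(2n+2)=R_1(n)+R_1(n+1),$$ $$R_2(2n)=4R_2(n),\qquad R_2(2n+1)=R_2(n)+R_2(n+1).$$
   Context: Cells are indexed by $(i,j)\in\mathbb Z^2$. For a binary configuration $c$ put $\Sigma^\times c_{i,j}=c_{i-1,j-1}+c_{i-1,j+1}+c_{i+1,j-1}+c_{i+1,j+1}$ and $\Sigma^+ c_{i,j}=c_{i,j-1}+c_{i,j+1}+c_{i+1,j}+c_{i-1,j}$. Two-state rules $c\mapsto f[c]$: $\mathcal C_1$: $c_{i,j}\mapsto \Sigma^\times c_{i,j}\bmod 2$; $\mathcal C_2$: $c_{i,j}\mapsto \Sigma^+ c_{i,j}\bmod 2$; $\mathcal C_3$: $c_{i,j}\mapsto 1$ if $\Sigma^+c_{i,j}=1$, else $0$; $\mathcal C_3'$: $c_{i,j}\mapsto 1$ if $\Sigma^+c_{i,j}=1$ and $\Sigma^\times c_{i,j}=0$, else $0$. The derived second-order automaton $\mathcal R_1,\mathcal R_2,\mathcal R_3,\mathcal R_3'$ has at each cell a pair of bits $(c,c')$ and updates all cells simultaneously by $(c,c')\mapsto (f[c]+c'\bmod 2,\ c)$, with $f[c]$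 computed from the first components of the neighbours. The value of a cell with state $(c,c')$ is $c+2c'$. -}

module Defs where

open import Data.Bool using (Bool; true; false; _xor_; if_then_else_)
open import Data.Nat using (ℕ; zero; suc; _+_; _*_; _≡ᵇ_)
open import Data.Integer as ℤ using (ℤ; +_)
open import Data.List using (List; map; upTo; length; filter; concatMap; _∷_; [])
open import Data.Product using (_×_; _,_; proj₁; proj₂)
open import Relation.Nullary.Decidable using (does)
open import Data.Nat.Properties using (_≟_)

Config : Set
Config = ℤ → ℤ → Bool

b2n : Bool → ℕ
b2n true  = 1
b2n false = 0

sumX : Config → ℤ → ℤ → ℕ
sumX c i j = b2n (c (i ℤ.- + 1) (j ℤ.- + 1)) + b2n (c (i ℤ.- + 1) (j ℤ.+ + 1))
           + b2n (c (i ℤ.+ + 1) (j ℤ.- + 1)) + b2n (c (i ℤ.+ + 1) (j ℤ.+ + 1))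

sumP : Config → ℤ → ℤ → ℕ
sumP c i j = b2n (c i (j ℤ.- + 1)) + b2n (c i (j ℤ.+ + 1))
           + b2n (c (i ℤ.+ + 1) j) + b2n (c (i ℤ.- + 1) j)

parity : ℕ → Bool
parity zero          = false
parity (suc zero)    = true
parity (suc (suc n)) = parity n

data Rule : Set where
  C1 C2 C3 C3' : Rule

applyRule : Rule → Config → Config
applyRule C1  c i j = parity (sumX c i j)
applyRule C2  c i j = parity (sumP c i j)
applyRule C3  c i j = sumP c i j ≡ᵇ 1
applyRule C3' c i j = if sumP c i j ≡ᵇ 1 then sumX c i j ≡ᵇ 0 else false

Config2 : Set
Config2 = Config × Config

step2 : Rule → Config2 → Config2
step2 r (c , c') = (λ i j → applyRule r c i j xor c' i j) , c

isOrigin : ℤ → ℤ → Bool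
isOrigin (+ 0) (+ 0) = true
isOrigin _     _     = false

init2 : Config2
init2 = isOrigin , (λ _ _ → false)

run : Rule → ℕ → Config2
run r zero    = init2
run r (suc n) = step2 r (run r n)

value : Config2 → ℤ → ℤ → ℕ
value (c , c') i j = b2n (c i j) + 2 * b2n (c' i j)

range : ℕ → List ℤ
range N = map (λ k → + k ℤ.- + N) (upTo (suc (N + N)))

box : ℕ → List (ℤ × ℤ)
box N = concatMap (λ i → map (λ j → (i , j)) (range N)) (range N)

countIn : ℕ → ℕ → Config2 → ℕ
countIn N v x = length (filter (λ p → value x (proj₁ p) (proj₂ p) ≟ v) (box N))

-- Since the neighbourhood
-- has radius 1 and the initial support is {(0,0)}, every cell outside
-- [-n,n]² is in state (0,0) after n steps, so counting inside this box
-- counts all cells of ℤ² with a nonzero value v.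
countAfter : Rule → ℕ → ℕ → ℕ
countAfter r v n = countIn n v (run r n)

R₁ : Rule → ℕ → ℕ
R₁ r n = countAfter r 1 n

R₂ : Rule → ℕ → ℕ
R₂ r n = countAfter r 2 n

module Submission where

-- Over GF(2) the rules C1 and C2 are linear: f[c] is the xor of the four translates of c by the
-- diagonal, resp. orthogonal, unit offsets.  The first components of the second-order automaton obey
-- c_{k+1} = f[c_k] ⊕ c_{k-1}, where c_{-1} = 0 and c_0 is the single live cell at the origin.
-- Squaring f kills the cross terms (Frobenius), so f (f (D g)) = D (f g) for the dilation D by 2,
-- and induction gives  c_{2n} = D (c_n ⊕ c_{n-1})  and  c_{2n+1} = f (D c_n).
-- So every c_{2n} lives on the cells with both coordinates even and every c_{2n+1} on a disjoint
-- parity class; hence the cells of value 1 (resp. 2) after n steps are the live cells of c_n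
-- (resp. c_{n-1}).  Dilation preserves the number of live cells and the four translates of D c_n
-- inside f (D c_n) do not overlap, which gives the four identities.
-- Along the C2 orbit no cell has exactly three live orthogonal neighbours, and a cell with exactly
-- one has no live diagonal neighbour; so C3 and C3' act there like C2 and run through the same orbit.

open import Defs
open import Algebra.Bundles using (CommutativeRing)
open import Data.Bool using (Bool; true; false; not; _∧_; _∨_; _xor_; if_then_else_)
open import Data.Bool.Properties
  using (not-involutive; not-¬; ¬-not; not-distribˡ-xor; not-distribʳ-xor;
         xor-assoc; xor-comm; xor-identityʳ; xor-same; if-eta; xor-∧-commutativeRing)
open import Algebra.Properties.CommutativeSemigroup (CommutativeRing.+-commutativeSemigroup xor-∧-commutativeRing)
  using (x∙yz≈xz∙y) renaming (interchange to xor-interchange)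
open import Data.Empty using (⊥; ⊥-elim)
open import Data.Integer as ℤ using (ℤ; +_; -[1+_]; ∣_∣)
open import Data.Integer.Properties using ([+m]-[+n]≡m⊖n; [1+m]⊖[1+n]≡m⊖n; ⊖-≥)
open import Data.List using (List; []; _∷_; _++_; map; length; filter; concatMap; applyUpTo)
open import Data.List.Properties using (map-++; map-∘; map-cong; map-upTo; map-applyUpTo; applyUpTo-∷ʳ)
open import Data.List.Relation.Unary.All using (All; []; _∷_; lookupWith)
open import Data.List.Relation.Unary.Any using (Any; here; there)
open import Data.List.Relation.Unary.AllPairs using (AllPairs; []; _∷_)
open import Data.Nat as ℕ using (ℕ; zero; suc; _+_; _*_; _≤_; _<_; z≤n; s≤s; ⌊_/2⌋; _≤′_; ≤′-refl; ≤′-step)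
open import Data.Nat.Induction using (<-rec)
open import Data.Nat.ListAction using (sum)
open import Data.Nat.ListAction.Properties using (sum-++)
open import Data.Nat.Properties
  using (_≟_; +-assoc; +-comm; +-suc; +-identityʳ; *-zeroʳ; m+n∸m≡n; n≡⌊n+n/2⌋;
         ≤-refl; ≤-trans; n≤1+n; m≤n⇒m≤1+n; m≤m+n; m≤n+m; +-mono-≤; +-monoʳ-≤; <⇒≱; ≤⇒≤′; ≤′⇒≤)
open import Data.Nat.Tactic.RingSolver using (solve-∀)
open import Data.Product using (_×_; _,_; proj₁; proj₂)
open import Data.Sum using (_⊎_; inj₁; inj₂)
open import Level using (0ℓ)
open import Relation.Binary.Bundles using (Setoid)
import Relation.Binary.Reasoning.Setoid as SetoidReasoning
open import Relation.Binary.PropositionalEquality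
  using (_≡_; _≢_; refl; sym; trans; cong; cong₂; subst; subst₂; module ≡-Reasoning)
open import Relation.Nullary using (does)
open import Relation.Unary using (Pred; Decidable)

-- Unit steps, parity and halving on ℤ

data Step : Set where
  down still up : Step

step : Step → ℤ → ℤ
step down  i = i ℤ.- + 1
step still i = i
step up    i = i ℤ.+ + 1

odd : ℤ → Bool
odd (+ n)    = parity n
odd -[1+ n ] = not (parity n)

-- ⌊ x / 2 ⌋, rounding towards -∞.
half : ℤ → ℤ
half (+ n)    = + ⌊ n /2⌋
half -[1+ n ] = -[1+ ⌊ n /2⌋ ]

parity-suc : ∀ n → parity (suc n) ≡ not (parity n)
parity-suc zero          = refl
parity-suc (suc zero)    = refl
parity-suc (suc (suc n)) = parity-suc n

parity-double : ∀ n → parity (n + n) ≡ false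
parity-double zero    = refl
parity-double (suc n) rewrite +-suc n n = parity-double n

⌊suc/2⌋ : ∀ n → ⌊ suc n /2⌋ ≡ (if parity n then suc ⌊ n /2⌋ else ⌊ n /2⌋)
⌊suc/2⌋ zero          = refl
⌊suc/2⌋ (suc zero)    = refl
⌊suc/2⌋ (suc (suc n)) with parity n | ⌊suc/2⌋ n
... | true  | e = cong suc e
... | false | e = cong suc e

up-+ : ∀ n → step up (+ n) ≡ + suc n
up-+ n = cong +_ (+-comm n 1)

down-neg : ∀ n → step down -[1+ n ] ≡ -[1+ suc n ]
down-neg n = cong (λ k → -[1+ suc k ]) (+-identityʳ n)

up-down : ∀ i → step up (step down i) ≡ i
up-down (+ zero)  = refl
up-down (+ suc n) = up-+ n
up-down -[1+ n ]  = cong (λ i → step up i) (down-neg n)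

down-up : ∀ i → step down (step up i) ≡ i
down-up (+ n)            = cong (step down) (up-+ n)
down-up -[1+ zero ]      = refl
down-up -[1+ suc n ]     = down-neg n

odd-up : ∀ i → odd (step up i) ≡ not (odd i)
odd-up (+ n)          rewrite +-comm n 1 = parity-suc n
odd-up -[1+ zero ]    = refl
odd-up -[1+ suc n ]   = trans (sym (parity-suc n)) (sym (not-involutive _))

odd-down : ∀ i → odd (step down i) ≡ not (odd i)
odd-down i = begin
  odd (step down i)                  ≡⟨ sym (not-involutive _) ⟩
  not (not (odd (step down i)))      ≡⟨ cong not (sym (odd-up (step down i))) ⟩
  not (odd (step up (step down i)))  ≡⟨ cong (λ k → not (odd k)) (up-down i) ⟩
  not (odd i)                        ∎
  where open ≡-Reasoning

odd-step² : ∀ a i → odd (step a (step a i)) ≡ odd i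
odd-step² down  i = trans (odd-down (step down i)) (trans (cong not (odd-down i)) (not-involutive _))
odd-step² still i = refl
odd-step² up    i = trans (odd-up (step up i)) (trans (cong not (odd-up i)) (not-involutive _))

half-up² : ∀ i → half (step up (step up i)) ≡ step up (half i)
half-up² (+ n)              rewrite +-comm (n + 1) 1 | +-comm n 1 = sym (up-+ ⌊ n /2⌋)
half-up² -[1+ zero ]        = refl
half-up² -[1+ suc zero ]    = refl
half-up² -[1+ suc (suc n) ] = refl

half-step² : ∀ a i → half (step a (step a i)) ≡ step a (half i)
half-step² down  i = begin
  half i₋₋                                  ≡⟨ sym (down-up (half i₋₋)) ⟩
  step down (step up (half i₋₋))            ≡⟨ cong (step down) (sym (half-up² i₋₋)) ⟩
  step down (half (step up (step up i₋₋)))  ≡⟨ cong (λ k → step down (half (step up k))) (up-down (step down i)) ⟩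
  step down (half (step up (step down i)))  ≡⟨ cong (λ k → step down (half k)) (up-down i) ⟩
  step down (half i)                        ∎
  where
  open ≡-Reasoning
  i₋₋ = step down (step down i)
half-step² still i = refl
half-step² up    i = half-up² i

step-comm : ∀ a b i → step a (step b i) ≡ step b (step a i)
step-comm down  down  i = refl
step-comm down  still i = refl
step-comm down  up    i = trans (down-up i) (sym (up-down i))
step-comm still b     i = refl
step-comm up    down  i = trans (up-down i) (sym (down-up i))
step-comm up    still i = refl
step-comm up    up    i = refl

∣i∣≤suc∣step∣ : ∀ a i → ∣ i ∣ ≤ suc ∣ step a i ∣
∣i∣≤suc∣step∣ down  (+ zero)            = z≤n
∣i∣≤suc∣step∣ down  (+ suc n)           = ≤-refl
∣i∣≤suc∣step∣ down  -[1+ n ]            rewrite +-identityʳ n = s≤s (m≤n⇒m≤1+n (n≤1+n n))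
∣i∣≤suc∣step∣ still i                   = n≤1+n ∣ i ∣
∣i∣≤suc∣step∣ up    (+ n)               rewrite +-comm n 1 = m≤n⇒m≤1+n (n≤1+n n)
∣i∣≤suc∣step∣ up    -[1+ zero ]         = s≤s z≤n
∣i∣≤suc∣step∣ up    -[1+ suc n ]        = ≤-refl

even⇒double-half : ∀ n → parity n ≡ false → n ≡ ⌊ n /2⌋ + ⌊ n /2⌋
even⇒double-half zero          e = refl
even⇒double-half (suc (suc n)) e = cong suc (trans (cong suc (even⇒double-half n e)) (sym (+-suc _ _)))

odd⇒double-half : ∀ n → parity n ≡ true → suc n ≡ suc ⌊ n /2⌋ + suc ⌊ n /2⌋
odd⇒double-half (suc zero)    e = refl
odd⇒double-half (suc (suc n)) e =
  cong suc (trans (cong suc (odd⇒double-half n e)) (sym (+-suc (suc ⌊ n /2⌋) (suc ⌊ n /2⌋))))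

∣even∣≡∣half∣+∣half∣ : ∀ x → odd x ≡ false → ∣ x ∣ ≡ ∣ half x ∣ + ∣ half x ∣
∣even∣≡∣half∣+∣half∣ (+ n)    e = even⇒double-half n e
∣even∣≡∣half∣+∣half∣ -[1+ n ] e = odd⇒double-half n (trans (sym (not-involutive _)) (cong not e))

⌊1+n+n/2⌋≡n : ∀ n → ⌊ suc (n + n) /2⌋ ≡ n
⌊1+n+n/2⌋≡n n rewrite ⌊suc/2⌋ (n + n) | parity-double n = sym (n≡⌊n+n/2⌋ n)

parity-1+n+n : ∀ n → parity (suc (n + n)) ≡ true
parity-1+n+n n = trans (parity-suc (n + n)) (cong not (parity-double n))

odd-moved : ∀ {a} → a ≢ still → ∀ x → odd (step a x) ≡ not (odd x)
odd-moved {down}  _  = odd-down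
odd-moved {still} a≢ = ⊥-elim (a≢ refl)
odd-moved {up}    _  = odd-up

moved-even⇒odd : ∀ {a} → a ≢ still → ∀ {x} → odd (step a x) ≡ false → odd x ≡ true
moved-even⇒odd a≢ {x} e = trans (sym (not-involutive (odd x))) (cong not (trans (sym (odd-moved a≢ x)) e))

half-up≡up-half-down : ∀ i → half (step up i) ≡ step up (half (step down i))
half-up≡up-half-down i = trans (cong (λ k → half (step up k)) (sym (up-down i))) (half-up² (step down i))

-- Sums over [-N, N]

dilate₁ : (ℤ → ℕ) → ℤ → ℕ
dilate₁ h x = if odd x then 0 else h (half x)

dilate₁-odd : ∀ h {x} → odd x ≡ true → dilate₁ h x ≡ 0
dilate₁-odd h e rewrite e = refl

dilate₁-even : ∀ h {x} → odd x ≡ false → dilate₁ h x ≡ h (half x)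
dilate₁-even h e rewrite e = refl

boxSum : ℕ → (ℤ → ℕ) → ℕ
boxSum zero    h = h (+ 0)
boxSum (suc N) h = h -[1+ N ] + boxSum N h + h (+ suc N)

boxSum-cong : ∀ N {h h′ : ℤ → ℕ} → (∀ x → h x ≡ h′ x) → boxSum N h ≡ boxSum N h′
boxSum-cong zero    e = e (+ 0)
boxSum-cong (suc N) e = cong₂ _+_ (cong₂ _+_ (e _) (boxSum-cong N e)) (e _)

boxSum-+ : ∀ N (h h′ : ℤ → ℕ) → boxSum N (λ x → h x + h′ x) ≡ boxSum N h + boxSum N h′
boxSum-+ zero    h h′ = refl
boxSum-+ (suc N) h h′ rewrite boxSum-+ N h h′ =
  shuffle (h -[1+ N ]) (h′ -[1+ N ]) (boxSum N h) (boxSum N h′) (h (+ suc N)) (h′ (+ suc N))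
  where
  shuffle : ∀ a a′ b b′ c c′ → a + a′ + (b + b′) + (c + c′) ≡ a + b + c + (a′ + b′ + c′)
  shuffle = solve-∀

boxSum-zero : ∀ N {h : ℤ → ℕ} → (∀ x → h x ≡ 0) → boxSum N h ≡ 0
boxSum-zero N {h} e = trans (boxSum-cong N e) (zeros N)
  where
  zeros : ∀ N → boxSum N (λ _ → 0) ≡ 0
  zeros zero    = refl
  zeros (suc N) rewrite zeros N = refl

VanishesBeyond : ℕ → (ℤ → ℕ) → Set
VanishesBeyond K h = ∀ x → K < ∣ x ∣ → h x ≡ 0

boxSum-stable : ∀ {K M} h → VanishesBeyond K h → K ≤ M → boxSum M h ≡ boxSum K h
boxSum-stable {K} h v K≤M = go (≤⇒≤′ K≤M)
  where
  go : ∀ {M} → K ≤′ M → boxSum M h ≡ boxSum K h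
  go ≤′-refl = refl
  go (≤′-step {M} p) rewrite v -[1+ M ] (s≤s (≤′⇒≤ p)) | v (+ suc M) (s≤s (≤′⇒≤ p)) =
    trans (+-identityʳ _) (go p)

boxSum-dilate : ∀ N h → boxSum (N + N) (dilate₁ h) ≡ boxSum N h
boxSum-dilate zero    h = refl
boxSum-dilate (suc N) h rewrite +-suc N N
  | dilate₁-odd h { -[1+ N + N ] } (cong not (parity-double N))
  | dilate₁-odd h {+ suc (N + N)} (parity-1+n+n N)
  | dilate₁-even h { -[1+ suc (N + N) ] } (cong not (parity-1+n+n N))
  | dilate₁-even h {+ suc (suc (N + N))} (parity-double N)
  | ⌊1+n+n/2⌋≡n N | sym (n≡⌊n+n/2⌋ N) | +-identityʳ (boxSum (N + N) (dilate₁ h))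
  = cong (λ b → h -[1+ N ] + b + h (+ suc N)) (boxSum-dilate N h)

up-neg : ∀ N → step up -[1+ N ] ≡ ℤ.- (+ N)
up-neg zero    = refl
up-neg (suc N) = refl

boxSum-up : ∀ N h → boxSum N (λ x → h (step up x)) + h (ℤ.- (+ N)) ≡ boxSum N h + h (+ suc N)
boxSum-up zero    h = +-comm (h (+ 1)) (h (+ 0))
boxSum-up (suc N) h rewrite up-neg N | up-+ (suc N) = begin
  h (ℤ.- (+ N)) + B′ + h (+ suc (suc N)) + h -[1+ N ]          ≡⟨ shuffle (h (ℤ.- (+ N))) B′ _ _ ⟩
  B′ + h (ℤ.- (+ N)) + ends                                     ≡⟨ cong (_+ ends) (boxSum-up N h) ⟩
  boxSum N h + h (+ suc N) + ends                               ≡⟨ shuffle′ (boxSum N h) (h (+ suc N)) (h -[1+ N ]) _ ⟩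
  h -[1+ N ] + boxSum N h + h (+ suc N) + h (+ suc (suc N))     ∎
  where
  open ≡-Reasoning
  B′ = boxSum N (λ x → h (step up x))
  ends = h -[1+ N ] + h (+ suc (suc N))
  shuffle : ∀ a b c d → a + b + c + d ≡ b + a + (d + c)
  shuffle = solve-∀
  shuffle′ : ∀ b e d c → b + e + (d + c) ≡ d + b + e + c
  shuffle′ = solve-∀

boxSum-down : ∀ N h → boxSum N (λ x → h (step down x)) + h (+ N) ≡ boxSum N h + h -[1+ N ]
boxSum-down zero    h = +-comm (h -[1+ 0 ]) (h (+ 0))
boxSum-down (suc N) h rewrite down-neg N = begin
  h -[1+ suc N ] + B′ + h (+ N) + h (+ suc N)   ≡⟨ shuffle (h -[1+ suc N ]) B′ (h (+ N)) (h (+ suc N)) ⟩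
  B′ + h (+ N) + ends                           ≡⟨ cong (_+ ends) (boxSum-down N h) ⟩
  boxSum N h + h -[1+ N ] + ends                ≡⟨ shuffle′ (boxSum N h) (h -[1+ N ]) (h -[1+ suc N ]) _ ⟩
  h -[1+ N ] + boxSum N h + h (+ suc N) + h -[1+ suc N ] ∎
  where
  open ≡-Reasoning
  B′ = boxSum N (λ x → h (step down x))
  ends = h -[1+ suc N ] + h (+ suc N)
  shuffle : ∀ a b c d → a + b + c + d ≡ b + c + (a + d)
  shuffle = solve-∀
  shuffle′ : ∀ b z x y → b + z + (x + y) ≡ z + b + y + x
  shuffle′ = solve-∀

cancel-zeros : ∀ {a b x y} → a + x ≡ b + y → x ≡ 0 → y ≡ 0 → a ≡ b
cancel-zeros {a} {b} e refl refl = trans (sym (+-identityʳ a)) (trans e (+-identityʳ b))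

boxSum-dilate-step : ∀ K h → VanishesBeyond K h → ∀ a →
                     boxSum (suc (K + K)) (λ x → dilate₁ h (step a x)) ≡ boxSum K h
boxSum-dilate-step K h v still
  rewrite dilate₁-odd h { -[1+ K + K ] } (cong not (parity-double K))
        | dilate₁-odd h {+ suc (K + K)} (parity-1+n+n K)
        | +-identityʳ (boxSum (K + K) (dilate₁ h)) = boxSum-dilate K h
boxSum-dilate-step K h v up =
  trans (cancel-zeros (boxSum-up N (dilate₁ h)) (dilate₁-odd h (cong not (parity-double K))) beyond)
        (boxSum-dilate-step K h v still)
  where
  N = suc (K + K)
  beyond : dilate₁ h (+ suc N) ≡ 0
  beyond rewrite dilate₁-even h {+ suc N} (parity-double K) | sym (n≡⌊n+n/2⌋ K) = v (+ suc K) ≤-refl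
boxSum-dilate-step K h v down =
  trans (cancel-zeros (boxSum-down N (dilate₁ h)) (dilate₁-odd h (parity-1+n+n K)) beyond)
        (boxSum-dilate-step K h v still)
  where
  N = suc (K + K)
  beyond : dilate₁ h -[1+ N ] ≡ 0
  beyond rewrite dilate₁-even h { -[1+ N ] } (cong not (parity-1+n+n K)) | ⌊1+n+n/2⌋≡n K = v -[1+ K ] ≤-refl

dilate₁-cong : ∀ {h h′ : ℤ → ℕ} → (∀ p → h p ≡ h′ p) → ∀ x → dilate₁ h x ≡ dilate₁ h′ x
dilate₁-cong e x with odd x
... | true  = refl
... | false = e (half x)

boxSum-dilate₁ : ∀ M (H : ℤ → ℤ → ℕ) x →
                 boxSum M (λ y → dilate₁ (λ p → H p y) x) ≡ dilate₁ (λ p → boxSum M (H p)) x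
boxSum-dilate₁ M H x with odd x
... | true  = boxSum-zero M (λ _ → refl)
... | false = refl

infix  4 _≐_
infixr 6 _⊕_

_≐_ : Config → Config → Set
g ≐ h = ∀ i j → g i j ≡ h i j

∅ : Config
∅ _ _ = false

_⊕_ : Config → Config → Config
(g ⊕ h) i j = g i j xor h i j

Offset : Set
Offset = Step × Step

shift : Offset → Config → Config
shift (a , b) g i j = g (step a i) (step b j)

dilate : Config → Config
dilate g i j = if odd i ∨ odd j then false else g (half i) (half j)

b2n-dilate : ∀ g i j → b2n (dilate g i j) ≡ dilate₁ (λ p → dilate₁ (λ q → b2n (g p q)) j) i
b2n-dilate g i j with odd i | odd j
... | true  | _     = refl
... | false | true  = refl
... | false | false = refl

SupportedIn : ℕ → Config → Set
SupportedIn K g = ∀ i j → g i j ≡ true → ∣ i ∣ ≤ K × ∣ j ∣ ≤ K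

Disjoint : Config → Config → Set
Disjoint g h = ∀ i j → g i j ≡ true → h i j ≡ true → ⊥

count : ℕ → Config → ℕ
count N g = boxSum N (λ i → boxSum N (λ j → b2n (g i j)))

count-cong : ∀ N {g h} → g ≐ h → count N g ≡ count N h
count-cong N e = boxSum-cong N (λ i → boxSum-cong N (λ j → cong b2n (e i j)))

count-⊕ : ∀ N {g h} → Disjoint g h → count N (g ⊕ h) ≡ count N g + count N h
count-⊕ N {g} {h} d = begin
  count N (g ⊕ h)                                                          ≡⟨ count-cells ⟩
  boxSum N (λ i → boxSum N (λ j → b2n (g i j)) + boxSum N (λ j → b2n (h i j))) ≡⟨ boxSum-+ N _ _ ⟩
  count N g + count N h                                                    ∎
  where
  open ≡-Reasoning
  b2n-xor : ∀ i j → b2n (g i j xor h i j) ≡ b2n (g i j) + b2n (h i j)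
  b2n-xor i j with g i j in gᵢⱼ | h i j in hᵢⱼ
  ... | true  | true  with () ← d i j gᵢⱼ hᵢⱼ
  ... | true  | false = refl
  ... | false | _     = refl
  count-cells = boxSum-cong N (λ i → trans (boxSum-cong N (b2n-xor i)) (boxSum-+ N _ _))

row-vanishes : ∀ {K g} → SupportedIn K g → ∀ i → VanishesBeyond K (λ j → b2n (g i j))
row-vanishes {g = g} s i j K<∣j∣ with g i j in gᵢⱼ
... | false = refl
... | true  with () ← <⇒≱ K<∣j∣ (proj₂ (s i j gᵢⱼ))

column-vanishes : ∀ {K g} → SupportedIn K g → ∀ M → VanishesBeyond K (λ i → boxSum M (λ j → b2n (g i j)))
column-vanishes {g = g} s M i K<∣i∣ = boxSum-zero M cell
  where
  cell : ∀ j → b2n (g i j) ≡ 0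
  cell j with g i j in gᵢⱼ
  ... | false = refl
  ... | true  with () ← <⇒≱ K<∣i∣ (proj₁ (s i j gᵢⱼ))

count-stable : ∀ {K M g} → SupportedIn K g → K ≤ M → count M g ≡ count K g
count-stable {K} {M} {g} s K≤M = begin
  count M g                                          ≡⟨ boxSum-cong M (λ i → boxSum-stable _ (row-vanishes s i) K≤M) ⟩
  boxSum M (λ i → boxSum K (λ j → b2n (g i j)))      ≡⟨ boxSum-stable _ (column-vanishes s K) K≤M ⟩
  count K g                                          ∎
  where open ≡-Reasoning

count-dilate-rows : ∀ M K (σ τ : ℤ → ℤ) g →
  (∀ p → boxSum M (λ y → dilate₁ (λ q → b2n (g p q)) (τ y)) ≡ boxSum K (λ q → b2n (g p q))) →
  boxSum M (λ x → dilate₁ (λ p → boxSum K (λ q → b2n (g p q))) (σ x)) ≡ count K g →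
  boxSum M (λ x → boxSum M (λ y → b2n (dilate g (σ x) (τ y)))) ≡ count K g
count-dilate-rows M K σ τ g rows columns = begin
  boxSum M (λ x → boxSum M (λ y → b2n (dilate g (σ x) (τ y))))
    ≡⟨ boxSum-cong M (λ x → boxSum-cong M (λ y → b2n-dilate g (σ x) (τ y))) ⟩
  boxSum M (λ x → boxSum M (λ y → dilate₁ (λ p → dilate₁ (λ q → b2n (g p q)) (τ y)) (σ x)))
    ≡⟨ boxSum-cong M (λ x → boxSum-dilate₁ M (λ p y → dilate₁ (λ q → b2n (g p q)) (τ y)) (σ x)) ⟩
  boxSum M (λ x → dilate₁ (λ p → boxSum M (λ y → dilate₁ (λ q → b2n (g p q)) (τ y))) (σ x))
    ≡⟨ boxSum-cong M (λ x → dilate₁-cong rows (σ x)) ⟩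
  boxSum M (λ x → dilate₁ (λ p → boxSum K (λ q → b2n (g p q))) (σ x))
    ≡⟨ columns ⟩
  count K g ∎
  where open ≡-Reasoning

count-dilate : ∀ N g → count (N + N) (dilate g) ≡ count N g
count-dilate N g = count-dilate-rows (N + N) N (λ x → x) (λ y → y) g
  (λ p → boxSum-dilate N _) (boxSum-dilate N _)

count-shift-dilate : ∀ {K g} → SupportedIn K g → ∀ s → count (suc (K + K)) (shift s (dilate g)) ≡ count K g
count-shift-dilate {K} {g} sup (a , b) = count-dilate-rows (suc (K + K)) K (step a) (step b) g
  (λ p → boxSum-dilate-step K _ (row-vanishes sup p) b)
  (boxSum-dilate-step K _ (column-vanishes sup K) a)

-- Box counts as list counts

range-suc : ∀ N → range (suc N) ≡ -[1+ N ] ∷ range N ++ + suc N ∷ []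
range-suc N = cong (-[1+ N ] ∷_) (begin
  map f (applyUpTo suc (suc N + suc N))           ≡⟨ map-applyUpTo suc f (suc N + suc N) ⟩
  applyUpTo (λ k → f (suc k)) (suc N + suc N)     ≡⟨ cong (applyUpTo (λ k → f (suc k))) (cong suc (+-suc N N)) ⟩
  applyUpTo (λ k → f (suc k)) (suc (suc (N + N))) ≡⟨ sym (applyUpTo-∷ʳ (λ k → f (suc k)) (suc (N + N))) ⟩
  applyUpTo (λ k → f (suc k)) (suc (N + N)) ++ f (suc (suc (N + N))) ∷ []
    ≡⟨ cong₂ (λ xs x → xs ++ x ∷ []) (trans (sym (map-upTo _ (suc (N + N)))) (map-cong f-suc _)) f-last ⟩
  range N ++ + suc N ∷ []                         ∎)
  where
  open ≡-Reasoning
  f : ℕ → ℤ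
  f k = + k ℤ.- + suc N
  f-suc : ∀ k → f (suc k) ≡ + k ℤ.- + N
  f-suc k = trans ([+m]-[+n]≡m⊖n (suc k) (suc N))
                  (trans ([1+m]⊖[1+n]≡m⊖n k N) (sym ([+m]-[+n]≡m⊖n k N)))
  f-last : f (suc (suc (N + N))) ≡ + suc N
  f-last = trans ([+m]-[+n]≡m⊖n (suc (suc (N + N))) (suc N))
                 (trans (⊖-≥ {suc (suc (N + N))} {suc N} (s≤s (m≤n⇒m≤1+n (m≤m+n N N))))
                        (cong +_ (trans (cong (ℕ._∸ suc N) (cong suc (sym (+-suc N N)))) (m+n∸m≡n (suc N) (suc N)))))

sum-range : ∀ N h → sum (map h (range N)) ≡ boxSum N h
sum-range zero    h = +-identityʳ (h (+ 0))
sum-range (suc N) h = begin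
  sum (map h (range (suc N)))                                    ≡⟨ cong (λ xs → sum (map h xs)) (range-suc N) ⟩
  h -[1+ N ] + sum (map h (range N ++ + suc N ∷ []))             ≡⟨ cong (λ n → h -[1+ N ] + n) inner ⟩
  h -[1+ N ] + (boxSum N h + h (+ suc N))                        ≡⟨ sym (+-assoc (h -[1+ N ]) (boxSum N h) _) ⟩
  boxSum (suc N) h                                               ∎
  where
  open ≡-Reasoning
  inner : sum (map h (range N ++ + suc N ∷ [])) ≡ boxSum N h + h (+ suc N)
  inner = begin
    sum (map h (range N ++ + suc N ∷ []))            ≡⟨ cong sum (map-++ h (range N) (+ suc N ∷ [])) ⟩
    sum (map h (range N) ++ h (+ suc N) ∷ [])        ≡⟨ sum-++ (map h (range N)) (h (+ suc N) ∷ []) ⟩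
    sum (map h (range N)) + (h (+ suc N) + 0)        ≡⟨ cong₂ _+_ (sum-range N h) (+-identityʳ (h (+ suc N))) ⟩
    boxSum N h + h (+ suc N)                         ∎

length-filter : ∀ {A : Set} {P : Pred A 0ℓ} (P? : Decidable P) xs →
                length (filter P? xs) ≡ sum (map (λ x → b2n (does (P? x))) xs)
length-filter P? []       = refl
length-filter P? (x ∷ xs) with does (P? x)
... | true  = cong suc (length-filter P? xs)
... | false = length-filter P? xs

sum-concatMap : ∀ {A B : Set} (f : B → ℕ) (F : A → List B) xs →
                sum (map f (concatMap F xs)) ≡ sum (map (λ x → sum (map f (F x))) xs)
sum-concatMap f F []       = refl
sum-concatMap f F (x ∷ xs) rewrite map-++ f (F x) (concatMap F xs) | sum-++ (map f (F x)) (map f (concatMap F xs)) =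
  cong (λ n → sum (map f (F x)) + n) (sum-concatMap f F xs)

countIn-count : ∀ N v x → countIn N v x ≡ count N (λ i j → does (value x i j ≟ v))
countIn-count N v x = begin
  length (filter P? (box N))                                      ≡⟨ length-filter P? (box N) ⟩
  sum (map φ (concatMap row (range N)))                           ≡⟨ sum-concatMap φ row (range N) ⟩
  sum (map (λ i → sum (map φ (map (i ,_) (range N)))) (range N))  ≡⟨ cong sum (map-cong rows (range N)) ⟩
  sum (map (λ i → boxSum N (λ j → φ (i , j))) (range N))          ≡⟨ sum-range N _ ⟩
  count N (λ i j → does (value x i j ≟ v))                        ∎
  where
  open ≡-Reasoning
  P? = λ (p : ℤ × ℤ) → value x (proj₁ p) (proj₂ p) ≟ v
  φ = λ (p : ℤ × ℤ) → b2n (does (P? p))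
  row = λ (i : ℤ) → map (i ,_) (range N)
  rows : ∀ i → sum (map φ (map (i ,_) (range N))) ≡ boxSum N (λ j → φ (i , j))
  rows i = trans (cong sum (sym (map-∘ (range N)))) (sum-range N _)

-- Configurations as a GF(2)-vector space

≐-setoid : Setoid 0ℓ 0ℓ
≐-setoid = record
  { Carrier       = Config
  ; _≈_           = _≐_
  ; isEquivalence = record
    { refl  = λ _ _ → refl
    ; sym   = λ e i j → sym (e i j)
    ; trans = λ e e′ i j → trans (e i j) (e′ i j)
    }
  }

open Setoid ≐-setoid using () renaming (refl to ≐-refl; sym to ≐-sym)

⊕-cong : ∀ {g g′ h h′} → g ≐ g′ → h ≐ h′ → g ⊕ h ≐ g′ ⊕ h′
⊕-cong e e′ i j = cong₂ _xor_ (e i j) (e′ i j)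

⊕-identityʳ : ∀ g → g ⊕ ∅ ≐ g
⊕-identityʳ g i j = xor-identityʳ (g i j)

⊕-cancelʳ : ∀ g h → (g ⊕ h) ⊕ h ≐ g
⊕-cancelʳ g h i j = begin
  (g i j xor h i j) xor h i j ≡⟨ xor-assoc (g i j) (h i j) (h i j) ⟩
  g i j xor (h i j xor h i j) ≡⟨ cong (g i j xor_) (xor-same (h i j)) ⟩
  g i j xor false             ≡⟨ xor-identityʳ (g i j) ⟩
  g i j                       ∎
  where open ≡-Reasoning

⊕-swap : ∀ g h k → g ⊕ h ⊕ k ≐ (g ⊕ k) ⊕ h
⊕-swap g h k i j = x∙yz≈xz∙y (g i j) (h i j) (k i j)

dilate-cong : ∀ {g h} → g ≐ h → dilate g ≐ dilate h
dilate-cong e i j = cong (if odd i ∨ odd j then false else_) (e (half i) (half j))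

origin-dilate : isOrigin ≐ dilate isOrigin
origin-dilate (+ zero)          (+ zero)          = refl
origin-dilate (+ zero)          (+ suc zero)      = refl
origin-dilate (+ zero)          (+ suc (suc n))   = sym (if-eta (parity n))
origin-dilate (+ zero)          -[1+ n ]          = sym (if-eta (not (parity n)))
origin-dilate (+ suc zero)      j                 = refl
origin-dilate (+ suc (suc m))   j                 = sym (if-eta (parity m ∨ odd j))
origin-dilate -[1+ m ]          j                 = sym (if-eta (not (parity m) ∨ odd j))

if-xor : ∀ b x y → (if b then false else x) xor (if b then false else y) ≡ (if b then false else x xor y)
if-xor true  x y = refl
if-xor false x y = refl

dilate-⊕ : ∀ g h → dilate (g ⊕ h) ≐ dilate g ⊕ dilate h
dilate-⊕ g h i j = sym (if-xor (odd i ∨ odd j) (g (half i) (half j)) (h (half i) (half j)))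

dilate-∅ : dilate ∅ ≐ ∅
dilate-∅ i j = if-eta (odd i ∨ odd j)

xorMap : {A : Set} → (A → Bool) → List A → Bool
xorMap f []       = false
xorMap f (x ∷ xs) = f x xor xorMap f xs

xorMap-cong : ∀ {A : Set} {f g : A → Bool} → (∀ x → f x ≡ g x) → ∀ xs → xorMap f xs ≡ xorMap g xs
xorMap-cong e []       = refl
xorMap-cong e (x ∷ xs) = cong₂ _xor_ (e x) (xorMap-cong e xs)

xorMap-xor : ∀ {A : Set} (f g : A → Bool) xs → xorMap (λ x → f x xor g x) xs ≡ xorMap f xs xor xorMap g xs
xorMap-xor f g []       = refl
xorMap-xor f g (x ∷ xs) rewrite xorMap-xor f g xs = xor-interchange (f x) (g x) (xorMap f xs) (xorMap g xs)

-- Frobenius in characteristic 2: the cross terms f s t and f t s cancel in pairs.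
xorMap-square : ∀ {A : Set} (f : A → A → Bool) → (∀ s t → f s t ≡ f t s) →
                ∀ xs → xorMap (λ s → xorMap (f s) xs) xs ≡ xorMap (λ s → f s s) xs
xorMap-square f sym-f []       = refl
xorMap-square f sym-f (x ∷ xs) = begin
  (f x x xor A) xor xorMap (λ s → f s x xor xorMap (f s) xs) xs ≡⟨ cong ((f x x xor A) xor_) (xorMap-xor _ _ xs) ⟩
  (f x x xor A) xor (B xor C)                                   ≡⟨ cong (λ b → (f x x xor A) xor (b xor C)) B≡A ⟩
  (f x x xor A) xor (A xor C)                                   ≡⟨ xor-assoc (f x x) A (A xor C) ⟩
  f x x xor (A xor (A xor C))                                   ≡⟨ cong (f x x xor_) (sym (xor-assoc A A C)) ⟩
  f x x xor ((A xor A) xor C)                                   ≡⟨ cong (λ b → f x x xor (b xor C)) (xor-same A) ⟩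
  f x x xor C                                                   ≡⟨ cong (f x x xor_) (xorMap-square f sym-f xs) ⟩
  f x x xor xorMap (λ s → f s s) xs                             ∎
  where
  open ≡-Reasoning
  A = xorMap (f x) xs
  B = xorMap (λ s → f s x) xs
  C = xorMap (λ s → xorMap (f s) xs) xs
  B≡A : B ≡ A
  B≡A = xorMap-cong (λ s → sym-f s x) xs

nbhdXor : List Offset → Config → Config
nbhdXor S g i j = xorMap (λ s → shift s g i j) S

nbhdXor-cong : ∀ S {g h} → g ≐ h → nbhdXor S g ≐ nbhdXor S h
nbhdXor-cong S e i j = xorMap-cong (λ (a , b) → e (step a i) (step b j)) S

nbhdXor-⊕ : ∀ S g h → nbhdXor S (g ⊕ h) ≐ nbhdXor S g ⊕ nbhdXor S h
nbhdXor-⊕ S g h i j = xorMap-xor (λ s → shift s g i j) (λ s → shift s h i j) S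

dilate-nbhdXor : ∀ S g → dilate (nbhdXor S g) ≐ (λ i j → xorMap (λ s → dilate (shift s g) i j) S)
dilate-nbhdXor []      g i j = dilate-∅ i j
dilate-nbhdXor (s ∷ S) g i j = trans (dilate-⊕ (shift s g) (nbhdXor S g) i j)
                                     (cong (dilate (shift s g) i j xor_) (dilate-nbhdXor S g i j))

dilate-shift² : ∀ g a b i j → dilate g (step a (step a i)) (step b (step b j)) ≡ dilate (shift (a , b) g) i j
dilate-shift² g a b i j rewrite odd-step² a i | odd-step² b j | half-step² a i | half-step² b j = refl

nbhdXor²-dilate : ∀ S g → nbhdXor S (nbhdXor S (dilate g)) ≐ dilate (nbhdXor S g)
nbhdXor²-dilate S g i j = begin
  xorMap (λ s → xorMap (λ t → twice s t) S) S  ≡⟨ xorMap-square twice twice-sym S ⟩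
  xorMap (λ s → twice s s) S                    ≡⟨ xorMap-cong (λ (a , b) → dilate-shift² g a b i j) S ⟩
  xorMap (λ s → dilate (shift s g) i j) S       ≡⟨ sym (dilate-nbhdXor S g i j) ⟩
  dilate (nbhdXor S g) i j                      ∎
  where
  open ≡-Reasoning
  twice : Offset → Offset → Bool
  twice (a , b) (c , d) = dilate g (step c (step a i)) (step d (step b j))
  twice-sym : ∀ s t → twice s t ≡ twice t s
  twice-sym (a , b) (c , d) = cong₂ (dilate g) (step-comm c a i) (step-comm d b j)

nbhdXor-any : ∀ S g i j → nbhdXor S g i j ≡ true → Any (λ s → shift s g i j ≡ true) S
nbhdXor-any (s ∷ S) g i j e with shift s g i j in gₛ
... | true  = here gₛ
... | false = there (nbhdXor-any S g i j e)

count-nbhdXor : ∀ N S {g} → AllPairs (λ s t → Disjoint (shift s g) (shift t g)) S →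
                count N (nbhdXor S g) ≡ sum (map (λ s → count N (shift s g)) S)
count-nbhdXor N []          _          = boxSum-zero N (λ i → boxSum-zero N (λ j → refl))
count-nbhdXor N (s ∷ S) {g} (ds ∷ dss) =
  trans (count-⊕ N apart) (cong (λ n → count N (shift s g) + n) (count-nbhdXor N S {g} dss))
  where
  apart : Disjoint (shift s g) (nbhdXor S g)
  apart i j gₛ rest = lookupWith (λ d gₜ → d i j gₛ gₜ) ds (nbhdXor-any S g i j rest)

sum-map-const : ∀ {A : Set} (xs : List A) c → sum (map (λ _ → c) xs) ≡ length xs * c
sum-map-const []       c = refl
sum-map-const (x ∷ xs) c = cong (λ n → c + n) (sum-map-const xs c)

-- Parity classes of cells

evenCells : Bool → Bool → Bool
evenCells a b = not (a ∨ b)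

InClass : (Bool → Bool → Bool) → Config → Set
InClass C g = ∀ i j → g i j ≡ true → C (odd i) (odd j) ≡ true

InClass-≐ : ∀ {C g h} → g ≐ h → InClass C h → InClass C g
InClass-≐ e c i j gᵢⱼ = c i j (trans (sym (e i j)) gᵢⱼ)

dilate-true : ∀ g i j → dilate g i j ≡ true → odd i ≡ false × odd j ≡ false × g (half i) (half j) ≡ true
dilate-true g i j = go (odd i) (odd j)
  where
  go : ∀ a b {x} → (if a ∨ b then false else x) ≡ true → a ≡ false × b ≡ false × x ≡ true
  go false false e = refl , refl , e

dilate-in-evenCells : ∀ g → InClass evenCells (dilate g)
dilate-in-evenCells g i j e with dilate-true g i j e
... | oᵢ , oⱼ , _ rewrite oᵢ | oⱼ = refl

SupportedIn-≐ : ∀ {K g h} → g ≐ h → SupportedIn K h → SupportedIn K g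
SupportedIn-≐ e s i j gᵢⱼ = s i j (trans (sym (e i j)) gᵢⱼ)

SupportedIn-suc : ∀ {K g} → SupportedIn K g → SupportedIn (suc K) g
SupportedIn-suc s i j gᵢⱼ = m≤n⇒m≤1+n (proj₁ (s i j gᵢⱼ)) , m≤n⇒m≤1+n (proj₂ (s i j gᵢⱼ))

SupportedIn-⊕ : ∀ {K g h} → SupportedIn K g → SupportedIn K h → SupportedIn K (g ⊕ h)
SupportedIn-⊕ {g = g} {h} s s′ i j e with g i j in gᵢⱼ
... | true  = s i j gᵢⱼ
... | false = s′ i j e

SupportedIn-origin : SupportedIn 0 isOrigin
SupportedIn-origin (+ zero) (+ zero) _ = z≤n , z≤n

SupportedIn-dilate : ∀ {K g} → SupportedIn K g → SupportedIn (K + K) (dilate g)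
SupportedIn-dilate {g = g} s i j e with dilate-true g i j e
... | oᵢ , oⱼ , g½ = subst (_≤ _) (sym (∣even∣≡∣half∣+∣half∣ i oᵢ)) (+-mono-≤ bound₁ bound₁)
                   , subst (_≤ _) (sym (∣even∣≡∣half∣+∣half∣ j oⱼ)) (+-mono-≤ bound₂ bound₂)
  where
  bound₁ = proj₁ (s _ _ g½)
  bound₂ = proj₂ (s _ _ g½)

SupportedIn-nbhdXor : ∀ S {K g} → SupportedIn K g → SupportedIn (suc K) (nbhdXor S g)
SupportedIn-nbhdXor S {g = g} s i j e = go (nbhdXor-any S g i j e)
  where
  go : ∀ {T} → Any (λ s → shift s g i j ≡ true) T → ∣ i ∣ ≤ suc _ × ∣ j ∣ ≤ suc _
  go (here {a , b} gₛ) = ≤-trans (∣i∣≤suc∣step∣ a i) (s≤s (proj₁ (s _ _ gₛ)))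
                       , ≤-trans (∣i∣≤suc∣step∣ b j) (s≤s (proj₂ (s _ _ gₛ)))
  go (there gₛ)        = go gₛ

dilate-even : ∀ g {i j} → odd i ≡ false → odd j ≡ false → dilate g i j ≡ g (half i) (half j)
dilate-even g {i} {j} = go
  where
  go : ∀ {a b x} → a ≡ false → b ≡ false → (if a ∨ b then false else x) ≡ x
  go refl refl = refl

dilate-odd-row : ∀ g x y → odd x ≡ true → dilate g x y ≡ false
dilate-odd-row g x y = go
  where
  go : ∀ {a b x} → a ≡ true → (if a ∨ b then false else x) ≡ false
  go refl = refl

outside-class : ∀ {C c} → InClass C c → ∀ x y → C (odd x) (odd y) ≡ false → c x y ≡ false
outside-class {c = c} cls x y f with c x y in e
... | false = refl
... | true  with () ← trans (sym (cls x y e)) f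

LandsIn : (Bool → Bool → Bool) → Offset → Set
LandsIn C (a , b) = ∀ x y → odd (step a x) ≡ false → odd (step b y) ≡ false → C (odd x) (odd y) ≡ true

nbhdXor-dilate-class : ∀ {C} S → All (LandsIn C) S → ∀ g → InClass C (nbhdXor S (dilate g))
nbhdXor-dilate-class {C} S cls g i j e = lookupWith (λ {s} → class-of {s}) cls (nbhdXor-any S (dilate g) i j e)
  where
  class-of : ∀ {s} → LandsIn C s → shift s (dilate g) i j ≡ true → C (odd i) (odd j) ≡ true
  class-of c d = c i j (proj₁ (dilate-true g _ _ d)) (proj₁ (proj₂ (dilate-true g _ _ d)))

dilate-moved-apart : ∀ {a} → a ≢ still → ∀ g x y y′ →
                     dilate g x y ≡ true → dilate g (step a x) y′ ≡ true → ⊥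
dilate-moved-apart a≢ g x y y′ d d′ with proj₁ (dilate-true g _ _ d) | proj₁ (dilate-true g _ _ d′)
... | ox | ox′ rewrite odd-moved a≢ x | ox with () ← ox′

dilate-horizontal : ∀ g i y y′ → dilate g (step down i) y ≡ true → dilate g (step up i) y′ ≡ true →
                    g (half (step down i)) (half y) ≡ true × g (step up (half (step down i))) (half y′) ≡ true
dilate-horizontal g i y y′ d d′ with dilate-true g _ _ d | dilate-true g _ _ d′
... | _ , _ , g₁ | _ , _ , g₂ = g₁ , subst (λ p → g p (half y′) ≡ true) (half-up≡up-half-down i) g₂

dilate-vertical : ∀ g x j → dilate g x (step down j) ≡ true → dilate g x (step up j) ≡ true →
                  g (half x) (half (step down j)) ≡ true × g (half x) (step up (half (step down j))) ≡ true
dilate-vertical g x j d d′ with dilate-true g _ _ d | dilate-true g _ _ d′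
... | _ , _ , g₁ | _ , _ , g₂ = g₁ , subst (λ q → g (half x) q ≡ true) (half-up≡up-half-down j) g₂

parity-+ : ∀ m n → parity (m + n) ≡ parity m xor parity n
parity-+ zero          n = refl
parity-+ (suc zero)    n = parity-suc n
parity-+ (suc (suc m)) n = parity-+ m n

parity-b2n : ∀ a → parity (b2n a) ≡ a
parity-b2n true  = refl
parity-b2n false = refl

parity-bits : ∀ a b c d → parity (b2n a + b2n b + b2n c + b2n d) ≡ a xor (b xor (c xor (d xor false)))
parity-bits a b c d
  rewrite parity-+ (b2n a + b2n b + b2n c) (b2n d) | parity-+ (b2n a + b2n b) (b2n c) | parity-+ (b2n a) (b2n b)
        | parity-b2n a | parity-b2n b | parity-b2n c | parity-b2n d | xor-identityʳ d
  = trans (xor-assoc (a xor b) c d) (xor-assoc a b (c xor d))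

diagonal orthogonal : List Offset
diagonal   = (down , down) ∷ (down , up) ∷ (up , down) ∷ (up , up) ∷ []
orthogonal = (still , down) ∷ (still , up) ∷ (up , still) ∷ (down , still) ∷ []

C1-is-diagonal : ∀ c → applyRule C1 c ≐ nbhdXor diagonal c
C1-is-diagonal c i j =
  parity-bits (shift (down , down) c i j) (shift (down , up) c i j) (shift (up , down) c i j) (shift (up , up) c i j)

C2-is-orthogonal : ∀ c → applyRule C2 c ≐ nbhdXor orthogonal c
C2-is-orthogonal c i j =
  parity-bits (shift (still , down) c i j) (shift (still , up) c i j) (shift (up , still) c i j) (shift (down , still) c i j)

-- orbit r k = c_{k-1}, so that run r n = (orbit r (suc n) , orbit r n).
orbit : Rule → ℕ → Config
orbit r k = proj₂ (run r k)

bits-cong : ∀ {a a′ b b′ c c′ d d′} → a ≡ a′ → b ≡ b′ → c ≡ c′ → d ≡ d′ →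
            b2n a + b2n b + b2n c + b2n d ≡ b2n a′ + b2n b′ + b2n c′ + b2n d′
bits-cong refl refl refl refl = refl

sumP-cong : ∀ {c c′} → c ≐ c′ → ∀ i j → sumP c i j ≡ sumP c′ i j
sumP-cong e i j = bits-cong (e i (step down j)) (e i (step up j)) (e (step up i) j) (e (step down i) j)

sumX-cong : ∀ {c c′} → c ≐ c′ → ∀ i j → sumX c i j ≡ sumX c′ i j
sumX-cong e i j = bits-cong (e (step down i) (step down j)) (e (step down i) (step up j))
                            (e (step up i) (step down j)) (e (step up i) (step up j))

applyRule-cong : ∀ r {c c′} → c ≐ c′ → applyRule r c ≐ applyRule r c′
applyRule-cong C1  e i j = cong parity (sumX-cong e i j)
applyRule-cong C2  e i j = cong parity (sumP-cong e i j)
applyRule-cong C3  e i j = cong (ℕ._≡ᵇ 1) (sumP-cong e i j)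
applyRule-cong C3' e i j =
  cong₂ (λ p x → if p ℕ.≡ᵇ 1 then x ℕ.≡ᵇ 0 else false) (sumP-cong e i j) (sumX-cong e i j)

-- Doubling for linear rules

data ParityView : ℕ → Set where
  twice   : ∀ m → ParityView (m + m)
  twice+1 : ∀ m → ParityView (suc (m + m))

parityView : ∀ n → ParityView n
parityView zero = twice zero
parityView (suc n) with parityView n
... | twice m   = twice+1 m
... | twice+1 m = subst ParityView (cong suc (+-suc m m)) (twice (suc m))

cells-with-value-1 : ∀ a b → (a ≡ true → b ≡ true → ⊥) → does (b2n a + 2 * b2n b ≟ 1) ≡ a
cells-with-value-1 true  true  d with () ← d refl refl
cells-with-value-1 true  false d = refl
cells-with-value-1 false true  d = refl
cells-with-value-1 false false d = refl

cells-with-value-2 : ∀ a b → (a ≡ true → b ≡ true → ⊥) → does (b2n a + 2 * b2n b ≟ 2) ≡ b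
cells-with-value-2 true  true  d with () ← d refl refl
cells-with-value-2 true  false d = refl
cells-with-value-2 false true  d = refl
cells-with-value-2 false false d = refl

DoublingLaws : ℕ → (ℕ → ℕ) → (ℕ → ℕ) → Set
DoublingLaws k f₁ f₂ = ∀ n →
  (f₁ (2 * n + 1) ≡ k * f₁ n) × (f₁ (2 * n + 2) ≡ f₁ n + f₁ (n + 1)) ×
  (f₂ (2 * n) ≡ k * f₂ n) × (f₂ (2 * n + 1) ≡ f₂ n + f₂ (n + 1))

2n≡n+n : ∀ n → 2 * n ≡ n + n
2n≡n+n = solve-∀

2n+1≡1+n+n : ∀ n → 2 * n + 1 ≡ suc (n + n)
2n+1≡1+n+n = solve-∀

2n+2≡1+n+1+n : ∀ n → 2 * n + 2 ≡ suc n + suc n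
2n+2≡1+n+1+n = solve-∀

module Doubling
  (S : List Offset) (C : Bool → Bool → Bool)
  (C-excludes-even : C false false ≡ false)
  (nbhd-in-C : ∀ g → InClass C (nbhdXor S (dilate g)))
  (translates-disjoint : ∀ g → InClass evenCells g ⊎ InClass C g →
                         AllPairs (λ s t → Disjoint (shift s (dilate g)) (shift t (dilate g))) S)
  where

  C-evenCells-disjoint : ∀ {g h} → InClass C g → InClass evenCells h → Disjoint g h
  C-evenCells-disjoint {g} {h} c e i j gᵢⱼ hᵢⱼ with odd i | odd j | c i j gᵢⱼ | e i j hᵢⱼ
  ... | false | false | Cᵢⱼ | _ with () ← trans (sym Cᵢⱼ) C-excludes-even

  count-nbhdXor-dilate : ∀ {K g} → SupportedIn K g → InClass evenCells g ⊎ InClass C g →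
                         count (suc (K + K)) (nbhdXor S (dilate g)) ≡ length S * count K g
  count-nbhdXor-dilate {K} {g} s c = begin
    count M (nbhdXor S (dilate g))                    ≡⟨ count-nbhdXor M S {dilate g} (translates-disjoint g c) ⟩
    sum (map (λ t → count M (shift t (dilate g))) S)  ≡⟨ cong sum (map-cong (count-shift-dilate s) S) ⟩
    sum (map (λ _ → count K g) S)                     ≡⟨ sum-map-const S (count K g) ⟩
    length S * count K g                              ∎
    where
    open ≡-Reasoning
    M = suc (K + K)

  module Orbit (r : Rule) (linear-on-orbit : ∀ k → applyRule r (orbit r k) ≐ nbhdXor S (orbit r k)) where

    orbit-step : ∀ k → orbit r (suc (suc k)) ≐ nbhdXor S (orbit r (suc k)) ⊕ orbit r k
    orbit-step k i j = cong (_xor orbit r k i j) (linear-on-orbit (suc k) i j)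

    orbit-doubling : ∀ n → orbit r (suc (n + n)) ≐ dilate (orbit r (suc n) ⊕ orbit r n)
                         × orbit r (suc (suc (n + n))) ≐ nbhdXor S (dilate (orbit r (suc n)))
    orbit-doubling zero = origin , first-step
      where
      open SetoidReasoning ≐-setoid
      origin : isOrigin ≐ dilate (isOrigin ⊕ ∅)
      origin = begin
        isOrigin                ≈⟨ origin-dilate ⟩
        dilate isOrigin         ≈⟨ dilate-cong (≐-sym (⊕-identityʳ isOrigin)) ⟩
        dilate (isOrigin ⊕ ∅)   ∎
      first-step : orbit r 2 ≐ nbhdXor S (dilate isOrigin)
      first-step = begin
        orbit r 2                      ≈⟨ orbit-step 0 ⟩
        nbhdXor S isOrigin ⊕ ∅         ≈⟨ ⊕-identityʳ _ ⟩
        nbhdXor S isOrigin             ≈⟨ nbhdXor-cong S origin-dilate ⟩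
        nbhdXor S (dilate isOrigin)    ∎
    orbit-doubling (suc n) = odd-step , even-step
      where
      open SetoidReasoning ≐-setoid
      U₀ = orbit r n
      U₁ = orbit r (suc n)
      U₂ = orbit r (suc (suc n))
      odd-step′ : orbit r (suc (suc (suc (n + n)))) ≐ dilate (U₂ ⊕ U₁)
      odd-step′ = begin
        orbit r (suc (suc (suc (n + n))))
          ≈⟨ orbit-step (suc (n + n)) ⟩
        nbhdXor S (orbit r (suc (suc (n + n)))) ⊕ orbit r (suc (n + n))
          ≈⟨ ⊕-cong (nbhdXor-cong S (proj₂ (orbit-doubling n))) (proj₁ (orbit-doubling n)) ⟩
        nbhdXor S (nbhdXor S (dilate U₁)) ⊕ dilate (U₁ ⊕ U₀)
          ≈⟨ ⊕-cong (nbhdXor²-dilate S U₁) (≐-refl {dilate (U₁ ⊕ U₀)}) ⟩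
        dilate (nbhdXor S U₁) ⊕ dilate (U₁ ⊕ U₀)
          ≈⟨ ≐-sym (dilate-⊕ (nbhdXor S U₁) (U₁ ⊕ U₀)) ⟩
        dilate (nbhdXor S U₁ ⊕ U₁ ⊕ U₀)
          ≈⟨ dilate-cong (⊕-swap (nbhdXor S U₁) U₁ U₀) ⟩
        dilate ((nbhdXor S U₁ ⊕ U₀) ⊕ U₁)
          ≈⟨ dilate-cong (⊕-cong (≐-sym (orbit-step n)) (≐-refl {U₁})) ⟩
        dilate (U₂ ⊕ U₁)
          ∎
      odd-step : orbit r (suc (suc n + suc n)) ≐ dilate (U₂ ⊕ U₁)
      odd-step = begin
        orbit r (suc (suc n + suc n))      ≡⟨ cong (λ m → orbit r (suc (suc m))) (+-suc n n) ⟩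
        orbit r (suc (suc (suc (n + n))))  ≈⟨ odd-step′ ⟩
        dilate (U₂ ⊕ U₁)                   ∎
      even-step : orbit r (suc (suc (suc n + suc n))) ≐ nbhdXor S (dilate U₂)
      even-step = begin
        orbit r (suc (suc (suc n + suc n)))
          ≡⟨ cong (λ m → orbit r (suc (suc (suc m)))) (+-suc n n) ⟩
        orbit r (suc (suc (suc (suc (n + n)))))
          ≈⟨ orbit-step (suc (suc (n + n))) ⟩
        nbhdXor S (orbit r (suc (suc (suc (n + n))))) ⊕ orbit r (suc (suc (n + n)))
          ≈⟨ ⊕-cong (nbhdXor-cong S odd-step′) (proj₂ (orbit-doubling n)) ⟩
        nbhdXor S (dilate (U₂ ⊕ U₁)) ⊕ nbhdXor S (dilate U₁)
          ≈⟨ ≐-sym (nbhdXor-⊕ S (dilate (U₂ ⊕ U₁)) (dilate U₁)) ⟩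
        nbhdXor S (dilate (U₂ ⊕ U₁) ⊕ dilate U₁)
          ≈⟨ nbhdXor-cong S (⊕-cong (dilate-⊕ U₂ U₁) (≐-refl {dilate U₁})) ⟩
        nbhdXor S ((dilate U₂ ⊕ dilate U₁) ⊕ dilate U₁)
          ≈⟨ nbhdXor-cong S (⊕-cancelʳ (dilate U₂) (dilate U₁)) ⟩
        nbhdXor S (dilate U₂)
          ∎

    orbit-odd : ∀ n → orbit r (suc (n + n)) ≐ dilate (orbit r (suc n) ⊕ orbit r n)
    orbit-odd n = proj₁ (orbit-doubling n)

    orbit-even : ∀ n → orbit r (suc n + suc n) ≐ nbhdXor S (dilate (orbit r (suc n)))
    orbit-even n i j = trans (cong (λ m → orbit r (suc m) i j) (+-suc n n)) (proj₂ (orbit-doubling n) i j)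

    orbit-odd-in-evenCells : ∀ m → InClass evenCells (orbit r (suc (m + m)))
    orbit-odd-in-evenCells m = InClass-≐ {evenCells} (orbit-odd m) (dilate-in-evenCells (orbit r (suc m) ⊕ orbit r m))

    orbit-even-in-C : ∀ m → InClass C (orbit r (m + m))
    orbit-even-in-C zero    i j ()
    orbit-even-in-C (suc m) = InClass-≐ {C} (orbit-even m) (nbhd-in-C (orbit r (suc m)))

    orbit-class : ∀ k → InClass evenCells (orbit r k) ⊎ InClass C (orbit r k)
    orbit-class k with parityView k
    ... | twice m   = inj₂ (orbit-even-in-C m)
    ... | twice+1 m = inj₁ (orbit-odd-in-evenCells m)

    orbit-disjoint : ∀ k → Disjoint (orbit r (suc k)) (orbit r k)
    orbit-disjoint k with parityView k
    ... | twice m   = λ i j p q → C-evenCells-disjoint (orbit-even-in-C m) (orbit-odd-in-evenCells m) i j q p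
    ... | twice+1 m = C-evenCells-disjoint next (orbit-odd-in-evenCells m)
      where
      next : InClass C (orbit r (suc (suc (m + m))))
      next = subst (λ n → InClass C (orbit r n)) (cong suc (+-suc m m)) (orbit-even-in-C (suc m))

    orbit-supported : ∀ k → SupportedIn k (orbit r (suc k)) × SupportedIn k (orbit r k)
    orbit-supported zero    = SupportedIn-origin , λ i j ()
    orbit-supported (suc k) = SupportedIn-≐ (orbit-step k) (SupportedIn-⊕ (SupportedIn-nbhdXor S current)
                                                                      (SupportedIn-suc previous))
                            , SupportedIn-suc current
      where
      current  = proj₁ (orbit-supported k)
      previous = proj₂ (orbit-supported k)

    count-orbit-stable : ∀ k → count k (orbit r (suc k)) ≡ count (suc k) (orbit r (suc k))
    count-orbit-stable k = sym (count-stable (proj₁ (orbit-supported k)) (n≤1+n k))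

    R₁-orbit : ∀ n → R₁ r n ≡ count n (orbit r (suc n))
    R₁-orbit n = trans (countIn-count n 1 (run r n))
      (count-cong n (λ i j → cells-with-value-1 (orbit r (suc n) i j) (orbit r n i j) (orbit-disjoint n i j)))

    R₂-orbit : ∀ n → R₂ r n ≡ count n (orbit r n)
    R₂-orbit n = trans (countIn-count n 2 (run r n))
      (count-cong n (λ i j → cells-with-value-2 (orbit r (suc n) i j) (orbit r n i j) (orbit-disjoint n i j)))

    R₁-at-odd : ∀ n → R₁ r (2 * n + 1) ≡ length S * R₁ r n
    R₁-at-odd n = begin
      R₁ r (2 * n + 1)
        ≡⟨ trans (cong (R₁ r) (2n+1≡1+n+n n)) (R₁-orbit (suc (n + n))) ⟩
      count (suc (n + n)) (orbit r (suc (suc (n + n))))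
        ≡⟨ count-cong (suc (n + n)) (proj₂ (orbit-doubling n)) ⟩
      count (suc (n + n)) (nbhdXor S (dilate (orbit r (suc n))))
        ≡⟨ count-nbhdXor-dilate (proj₁ (orbit-supported n)) (orbit-class (suc n)) ⟩
      length S * count n (orbit r (suc n))
        ≡⟨ cong (length S *_) (sym (R₁-orbit n)) ⟩
      length S * R₁ r n
        ∎
      where open ≡-Reasoning

    R₁-at-even : ∀ n → R₁ r (2 * n + 2) ≡ R₁ r n + R₁ r (n + 1)
    R₁-at-even n = begin
      R₁ r (2 * n + 2)
        ≡⟨ trans (cong (R₁ r) (2n+2≡1+n+1+n n)) (R₁-orbit (suc n + suc n)) ⟩
      count (suc n + suc n) (orbit r (suc (suc n + suc n)))
        ≡⟨ count-cong (suc n + suc n) (orbit-odd (suc n)) ⟩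
      count (suc n + suc n) (dilate (U₂ ⊕ U₁))
        ≡⟨ count-dilate (suc n) (U₂ ⊕ U₁) ⟩
      count (suc n) (U₂ ⊕ U₁)
        ≡⟨ count-⊕ (suc n) (orbit-disjoint (suc n)) ⟩
      count (suc n) U₂ + count (suc n) U₁
        ≡⟨ cong₂ _+_ (sym (R₁-orbit (suc n))) (sym (trans (R₁-orbit n) (count-orbit-stable n))) ⟩
      R₁ r (suc n) + R₁ r n
        ≡⟨ trans (+-comm (R₁ r (suc n)) (R₁ r n)) (cong (λ m → R₁ r n + R₁ r m) (+-comm 1 n)) ⟩
      R₁ r n + R₁ r (n + 1)
        ∎
      where
      open ≡-Reasoning
      U₁ = orbit r (suc n)
      U₂ = orbit r (suc (suc n))

    R₂-at-even : ∀ n → R₂ r (2 * n) ≡ length S * R₂ r n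
    R₂-at-even zero    = trans (R₂-orbit 0) (sym (trans (cong (length S *_) (R₂-orbit 0)) (*-zeroʳ (length S))))
    R₂-at-even (suc m) = begin
      R₂ r (2 * suc m)
        ≡⟨ trans (cong (R₂ r) (2n≡n+n (suc m))) (R₂-orbit (suc m + suc m)) ⟩
      count (suc m + suc m) (orbit r (suc m + suc m))
        ≡⟨ count-cong (suc m + suc m) (orbit-even m) ⟩
      count (suc m + suc m) (nbhdXor S (dilate U₁))
        ≡⟨ count-stable supported (s≤s (+-monoʳ-≤ m (n≤1+n m))) ⟩
      count (suc (m + m)) (nbhdXor S (dilate U₁))
        ≡⟨ count-nbhdXor-dilate (proj₁ (orbit-supported m)) (orbit-class (suc m)) ⟩
      length S * count m U₁
        ≡⟨ cong (length S *_) (trans (count-orbit-stable m) (sym (R₂-orbit (suc m)))) ⟩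
      length S * R₂ r (suc m)
        ∎
      where
      open ≡-Reasoning
      U₁ = orbit r (suc m)
      supported : SupportedIn (suc (m + m)) (nbhdXor S (dilate U₁))
      supported = SupportedIn-nbhdXor S (SupportedIn-dilate (proj₁ (orbit-supported m)))

    R₂-at-odd : ∀ n → R₂ r (2 * n + 1) ≡ R₂ r n + R₂ r (n + 1)
    R₂-at-odd n = begin
      R₂ r (2 * n + 1)
        ≡⟨ trans (cong (R₂ r) (2n+1≡1+n+n n)) (R₂-orbit (suc (n + n))) ⟩
      count (suc (n + n)) (orbit r (suc (n + n)))
        ≡⟨ count-cong (suc (n + n)) (orbit-odd n) ⟩
      count (suc (n + n)) (dilate (U₁ ⊕ U₀))
        ≡⟨ count-shift-dilate supported (still , still) ⟩
      count n (U₁ ⊕ U₀)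
        ≡⟨ count-⊕ n (orbit-disjoint n) ⟩
      count n U₁ + count n U₀
        ≡⟨ cong₂ _+_ (trans (count-orbit-stable n) (sym (R₂-orbit (suc n)))) (sym (R₂-orbit n)) ⟩
      R₂ r (suc n) + R₂ r n
        ≡⟨ trans (+-comm (R₂ r (suc n)) (R₂ r n)) (cong (λ m → R₂ r n + R₂ r m) (+-comm 1 n)) ⟩
      R₂ r n + R₂ r (n + 1)
        ∎
      where
      open ≡-Reasoning
      U₀ = orbit r n
      U₁ = orbit r (suc n)
      supported : SupportedIn n (U₁ ⊕ U₀)
      supported = SupportedIn-⊕ (proj₁ (orbit-supported n)) (proj₂ (orbit-supported n))

    laws : DoublingLaws (length S) (R₁ r) (R₂ r)
    laws n = R₁-at-odd n , R₁-at-even n , R₂-at-even n , R₂-at-odd n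

-- The rules C1 and C2

oddCells : Bool → Bool → Bool
oddCells a b = a ∧ b

parity-constant : ∀ {g} → InClass evenCells g ⊎ InClass oddCells g →
                  ∀ p q p′ q′ → g p q ≡ true → g p′ q′ ≡ true → odd p ≡ odd p′ × odd q ≡ odd q′
parity-constant (inj₁ c) p q p′ q′ e e′ with odd p | odd q | odd p′ | odd q′ | c p q e | c p′ q′ e′
... | false | false | false | false | _ | _ = refl , refl
parity-constant (inj₂ c) p q p′ q′ e e′ with odd p | odd q | odd p′ | odd q′ | c p q e | c p′ q′ e′
... | true  | true  | true  | true  | _ | _ = refl , refl

diagonal-class : ∀ g → InClass oddCells (nbhdXor diagonal (dilate g))
diagonal-class = nbhdXor-dilate-class {oddCells} diagonal
  (both-moved {down} {down} (λ ()) (λ ()) ∷ both-moved {down} {up} (λ ()) (λ ()) ∷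
   both-moved {up} {down} (λ ()) (λ ()) ∷ both-moved {up} {up} (λ ()) (λ ()) ∷ [])
  where
  both-moved : ∀ {a b} → a ≢ still → b ≢ still →
               ∀ x y → odd (step a x) ≡ false → odd (step b y) ≡ false → oddCells (odd x) (odd y) ≡ true
  both-moved a≢ b≢ x y ox oy = cong₂ _∧_ (moved-even⇒odd a≢ ox) (moved-even⇒odd b≢ oy)

diagonal-translates-disjoint : ∀ g → InClass evenCells g ⊎ InClass oddCells g →
                               AllPairs (λ s t → Disjoint (shift s (dilate g)) (shift t (dilate g))) diagonal
diagonal-translates-disjoint g c =
  (vertical down ∷ horizontal {down} {down} ∷ horizontal {down} {up} ∷ []) ∷
  (horizontal {up} {down} ∷ horizontal {up} {up} ∷ []) ∷ (vertical up ∷ []) ∷ [] ∷ []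
  where
  horizontal : ∀ {b b′} → Disjoint (shift (down , b) (dilate g)) (shift (up , b′) (dilate g))
  horizontal {b} {b′} i j d d′ with dilate-horizontal g i (step b j) (step b′ j) d d′
  ... | g₁ , g₂ = not-¬ (proj₁ (parity-constant c _ _ _ _ g₂ g₁)) (odd-up (half (step down i)))
  vertical : ∀ a → Disjoint (shift (a , down) (dilate g)) (shift (a , up) (dilate g))
  vertical a i j d d′ with dilate-vertical g (step a i) j d d′
  ... | g₁ , g₂ = not-¬ (proj₂ (parity-constant c _ _ _ _ g₂ g₁)) (odd-up (half (step down j)))

module DiagonalDoubling = Doubling diagonal oddCells refl diagonal-class diagonal-translates-disjoint

mixedCells : Bool → Bool → Bool
mixedCells a b = a xor b

colour-constant : ∀ {g} → InClass evenCells g ⊎ InClass mixedCells g →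
                  ∀ p q p′ q′ → g p q ≡ true → g p′ q′ ≡ true → odd p xor odd q ≡ odd p′ xor odd q′
colour-constant (inj₁ c) p q p′ q′ e e′ with odd p | odd q | odd p′ | odd q′ | c p q e | c p′ q′ e′
... | false | false | false | false | _ | _ = refl
colour-constant (inj₂ c) p q p′ q′ e e′ = trans (c p q e) (sym (c p′ q′ e′))

orthogonal-class : ∀ g → InClass mixedCells (nbhdXor orthogonal (dilate g))
orthogonal-class = nbhdXor-dilate-class {mixedCells} orthogonal
  (second-moved {down} (λ ()) ∷ second-moved {up} (λ ()) ∷ first-moved {up} (λ ()) ∷ first-moved {down} (λ ()) ∷ [])
  where
  second-moved : ∀ {b} → b ≢ still →
                 ∀ x y → odd x ≡ false → odd (step b y) ≡ false → mixedCells (odd x) (odd y) ≡ true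
  second-moved b≢ x y ox oy = cong₂ _xor_ ox (moved-even⇒odd b≢ oy)
  first-moved : ∀ {a} → a ≢ still →
                ∀ x y → odd (step a x) ≡ false → odd y ≡ false → mixedCells (odd x) (odd y) ≡ true
  first-moved a≢ x y ox oy = cong₂ _xor_ (moved-even⇒odd a≢ ox) oy

colour-flip₁ : ∀ {a} → a ≢ still → ∀ p q → odd (step a p) xor odd q ≡ not (odd p xor odd q)
colour-flip₁ a≢ p q = trans (cong (_xor odd q) (odd-moved a≢ p)) (sym (not-distribˡ-xor (odd p) (odd q)))

colour-flip₂ : ∀ {b} → b ≢ still → ∀ p q → odd p xor odd (step b q) ≡ not (odd p xor odd q)
colour-flip₂ b≢ p q = trans (cong (odd p xor_) (odd-moved b≢ q)) (sym (not-distribʳ-xor (odd p) (odd q)))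

rook-apart₁ : ∀ {g} → InClass evenCells g ⊎ InClass mixedCells g →
              ∀ {a} → a ≢ still → ∀ p q → g p q ≡ true → g (step a p) q ≡ true → ⊥
rook-apart₁ c a≢ p q e e′ = not-¬ (colour-constant c _ _ _ _ e′ e) (colour-flip₁ a≢ p q)

rook-apart₂ : ∀ {g} → InClass evenCells g ⊎ InClass mixedCells g →
              ∀ {b} → b ≢ still → ∀ p q → g p q ≡ true → g p (step b q) ≡ true → ⊥
rook-apart₂ c b≢ p q e e′ = not-¬ (colour-constant c _ _ _ _ e′ e) (colour-flip₂ b≢ p q)

orthogonal-translates-disjoint : ∀ g → InClass evenCells g ⊎ InClass mixedCells g →
                                 AllPairs (λ s t → Disjoint (shift s (dilate g)) (shift t (dilate g))) orthogonal
orthogonal-translates-disjoint g c =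
  (vertical ∷ across {up} {down} (λ ()) ∷ across {down} {down} (λ ()) ∷ []) ∷
  (across {up} {up} (λ ()) ∷ across {down} {up} (λ ()) ∷ []) ∷ (horizontal ∷ []) ∷ [] ∷ []
  where
  vertical : Disjoint (shift (still , down) (dilate g)) (shift (still , up) (dilate g))
  vertical i j d d′ with dilate-vertical g i j d d′
  ... | g₁ , g₂ = rook-apart₂ c {up} (λ ()) _ _ g₁ g₂
  horizontal : Disjoint (shift (up , still) (dilate g)) (shift (down , still) (dilate g))
  horizontal i j d d′ with dilate-horizontal g i j j d′ d
  ... | g₁ , g₂ = rook-apart₁ c {up} (λ ()) _ _ g₁ g₂
  across : ∀ {a b} → a ≢ still → Disjoint (shift (still , b) (dilate g)) (shift (a , still) (dilate g))
  across {b = b} a≢ i j d d′ = dilate-moved-apart a≢ g i (step b j) j d d′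

module OrthogonalDoubling = Doubling orthogonal mixedCells refl orthogonal-class orthogonal-translates-disjoint

module C2-orbit = OrthogonalDoubling.Orbit C2 (λ k → C2-is-orthogonal (orbit C2 k))

-- The C2 orbit in detail

NoThree : Config → Set
NoThree c = ∀ i j → sumP c i j ≢ 3

two-bits : ∀ a b → b2n a + b2n b ≢ 3
two-bits true  true  ()
two-bits true  false ()
two-bits false true  ()
two-bits false false ()

at-most-two : ∀ a b c d → (a ≡ false × b ≡ false) ⊎ (c ≡ false × d ≡ false) →
              b2n a + b2n b + b2n c + b2n d ≢ 3
at-most-two a b c d (inj₁ (refl , refl)) = two-bits c d
at-most-two a b c d (inj₂ (refl , refl)) e = two-bits a b (trans (sym (+-identityʳ _)) (trans (sym (+-identityʳ _)) e))

evenCells-odd-row : ∀ {c} → InClass evenCells c → ∀ x y → odd x ≡ true → c x y ≡ false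
evenCells-odd-row cls x y o = outside-class {evenCells} cls x y (cong (λ a → not (a ∨ odd y)) o)

evenCells-no-three : ∀ {c} → InClass evenCells c → NoThree c
evenCells-no-three {c} cls i j with odd i in oᵢ
... | false = at-most-two (c i (step down j)) (c i (step up j)) (c (step up i) j) (c (step down i) j)
                (inj₂ (evenCells-odd-row cls (step up i) j (trans (odd-up i) (cong not oᵢ))
                     , evenCells-odd-row cls (step down i) j (trans (odd-down i) (cong not oᵢ))))
... | true  = at-most-two (c i (step down j)) (c i (step up j)) (c (step up i) j) (c (step down i) j)
                (inj₁ (evenCells-odd-row cls i (step down j) oᵢ , evenCells-odd-row cls i (step up j) oᵢ))

module EvenCell (g : Config) {i j : ℤ} (oᵢ : odd i ≡ false) (oⱼ : odd j ≡ false) where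

  private
    c = nbhdXor orthogonal (dilate g)
    p = half i
    q = half j
    G = g p q

    odd-up-i : odd (step up i) ≡ true
    odd-up-i = trans (odd-up i) (cong not oᵢ)

    odd-down-i : odd (step down i) ≡ true
    odd-down-i = trans (odd-down i) (cong not oᵢ)

    shifted : ∀ a b → dilate g (step a (step a i)) (step b (step b j)) ≡ g (step a p) (step b q)
    shifted a b = trans (dilate-shift² g a b i j) (dilate-even (shift (a , b) g) oᵢ oⱼ)

    centre : ∀ {x y} → x ≡ i → y ≡ j → dilate g x y ≡ G
    centre refl refl = dilate-even g oᵢ oⱼ

    xor-G : ∀ n → n xor (G xor false) ≡ n xor G
    xor-G n = cong (n xor_) (xor-identityʳ G)

    G-xor : ∀ n → G xor (n xor false) ≡ n xor G
    G-xor n = trans (cong (G xor_) (xor-identityʳ n)) (xor-comm G n)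

  below : c i (step down j) ≡ g p (step down q) xor G
  below = trans (cong₂ _xor_ (shifted still down) (cong₂ _xor_ (centre refl (up-down j))
                  (cong₂ _xor_ (dilate-odd-row g (step up i) (step down j) odd-up-i)
                               (cong (_xor false) (dilate-odd-row g (step down i) (step down j) odd-down-i)))))
                (xor-G (g p (step down q)))

  above : c i (step up j) ≡ g p (step up q) xor G
  above = trans (cong₂ _xor_ (centre refl (down-up j)) (cong₂ _xor_ (shifted still up)
                  (cong₂ _xor_ (dilate-odd-row g (step up i) (step up j) odd-up-i)
                               (cong (_xor false) (dilate-odd-row g (step down i) (step up j) odd-down-i)))))
                (G-xor (g p (step up q)))

  right : c (step up i) j ≡ g (step up p) q xor G
  right = trans (cong₂ _xor_ (dilate-odd-row g (step up i) (step down j) odd-up-i)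
                  (cong₂ _xor_ (dilate-odd-row g (step up i) (step up j) odd-up-i)
                    (cong₂ _xor_ (shifted up still) (cong (_xor false) (centre (down-up i) refl)))))
                (xor-G (g (step up p) q))

  left : c (step down i) j ≡ g (step down p) q xor G
  left = trans (cong₂ _xor_ (dilate-odd-row g (step down i) (step down j) odd-down-i)
                 (cong₂ _xor_ (dilate-odd-row g (step down i) (step up j) odd-down-i)
                   (cong₂ _xor_ (centre (up-down i) refl) (cong (_xor false) (shifted down still)))))
               (G-xor (g (step down p) q))

  sumP-at-even-cell : sumP c i j ≡ sumP (λ x y → g x y xor G) p q
  sumP-at-even-cell = bits-cong below above right left

-- The configurations just before and after this one are dilations and so vanish off the even
-- cells; by the recurrence its orthogonal neighbourhood sum is then even there.
C2-even-orbit-off-evenCells : ∀ m i j → evenCells (odd i) (odd j) ≡ false → sumP (orbit C2 (suc m + suc m)) i j ≢ 3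
C2-even-orbit-off-evenCells m i j e three = true≢false (trans (sym (cong parity three)) sum-even)
  where
  open ≡-Reasoning
  true≢false : true ≢ false
  true≢false ()
  previous = orbit C2 (m + suc m)
  next-in-evenCells : InClass evenCells (orbit C2 (suc (suc m + suc m)))
  next-in-evenCells = C2-orbit.orbit-odd-in-evenCells (suc m)
  previous-in-evenCells : InClass evenCells previous
  previous-in-evenCells = subst (λ n → InClass evenCells (orbit C2 n)) (sym (+-suc m m)) (C2-orbit.orbit-odd-in-evenCells m)
  sum-even : parity (sumP (orbit C2 (suc m + suc m)) i j) ≡ false
  sum-even = begin
    applyRule C2 (orbit C2 (suc m + suc m)) i j
      ≡⟨ sym (⊕-cancelʳ (applyRule C2 (orbit C2 (suc m + suc m))) previous i j) ⟩
    orbit C2 (suc (suc m + suc m)) i j xor previous i j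
      ≡⟨ cong₂ _xor_ (outside-class {evenCells} next-in-evenCells i j e)
                     (outside-class {evenCells} previous-in-evenCells i j e) ⟩
    false
      ∎

rook-sum : ∀ {a b c d} → a ≡ false → b ≡ false → c ≡ false → d ≡ false →
           b2n (a xor true) + b2n (b xor true) + b2n (c xor true) + b2n (d xor true) ≡ 4
rook-sum refl refl refl refl = refl

C2-even-orbit-no-three : ∀ m → NoThree (orbit C2 (suc m)) → NoThree (orbit C2 (suc m + suc m))
C2-even-orbit-no-three m ih i j with odd i in oᵢ | odd j in oⱼ
... | true  | _     = C2-even-orbit-off-evenCells m i j (cong₂ evenCells oᵢ oⱼ)
... | false | true  = C2-even-orbit-off-evenCells m i j (cong₂ evenCells oᵢ oⱼ)
... | false | false = λ three → centre-case (g p q) refl (trans (sym at-even-cell) three)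
  where
  g = orbit C2 (suc m)
  p = half i
  q = half j
  cls : InClass evenCells g ⊎ InClass mixedCells g
  at-even-cell : sumP (orbit C2 (suc m + suc m)) i j ≡ sumP (λ x y → g x y xor g p q) p q
  at-even-cell = trans (sumP-cong (C2-orbit.orbit-even m) i j) (EvenCell.sumP-at-even-cell g oᵢ oⱼ)
  centre-case : ∀ G → g p q ≡ G → sumP (λ x y → g x y xor G) p q ≢ 3
  centre-case false _  three = ih p q (trans (sym (sumP-cong (λ x y → xor-identityʳ (g x y)) p q)) three)
  centre-case true  gG three with () ← trans (sym (rook-sum (¬-not (rook-apart₂ cls {down} (λ ()) p q gG))
                                                            (¬-not (rook-apart₂ cls {up} (λ ()) p q gG))
                                                            (¬-not (rook-apart₁ cls {up} (λ ()) p q gG))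
                                                            (¬-not (rook-apart₁ cls {down} (λ ()) p q gG)))) three
  cls = C2-orbit.orbit-class (suc m)

C2-orbit-no-three : ∀ k → NoThree (orbit C2 k)
C2-orbit-no-three = <-rec (λ k → NoThree (orbit C2 k)) by-halving
  where
  by-halving : ∀ k → (∀ {m} → m < k → NoThree (orbit C2 m)) → NoThree (orbit C2 k)
  by-halving k rec with parityView k
  ... | twice zero    = λ i j ()
  ... | twice (suc m) = C2-even-orbit-no-three m (rec (s≤s (m≤n+m (suc m) m)))
  ... | twice+1 m     = evenCells-no-three (C2-orbit.orbit-odd-in-evenCells m)

RookExcludesDiagonal : (Bool → Bool → Bool) → Set
RookExcludesDiagonal C = ∀ α β → C α (not β) ≡ true ⊎ C (not α) β ≡ true → C (not α) (not β) ≡ false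

evenCells-rook-diagonal : RookExcludesDiagonal evenCells
evenCells-rook-diagonal false false _        = refl
evenCells-rook-diagonal false true  _        = refl
evenCells-rook-diagonal true  false _        = refl
evenCells-rook-diagonal true  true  (inj₁ ())
evenCells-rook-diagonal true  true  (inj₂ ())

mixedCells-rook-diagonal : RookExcludesDiagonal mixedCells
mixedCells-rook-diagonal false false _        = refl
mixedCells-rook-diagonal true  true  _        = refl
mixedCells-rook-diagonal false true  (inj₁ ())
mixedCells-rook-diagonal false true  (inj₂ ())
mixedCells-rook-diagonal true  false (inj₁ ())
mixedCells-rook-diagonal true  false (inj₂ ())

no-diagonal-beside-lone-rook : ∀ {C c} → RookExcludesDiagonal C → InClass C c → ∀ i j → sumP c i j ≡ 1 → sumX c i j ≡ 0
no-diagonal-beside-lone-rook {C} {c} excludes cls i j one =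
  bits-cong (off {down} {down} (λ ()) (λ ())) (off {down} {up} (λ ()) (λ ()))
            (off {up} {down} (λ ()) (λ ())) (off {up} {up} (λ ()) (λ ()))
  where
  RookClass = C (odd i) (not (odd j)) ≡ true ⊎ C (not (odd i)) (odd j) ≡ true
  vertical : ∀ {b} → b ≢ still → c i (step b j) ≡ true → RookClass
  vertical b≢ e = inj₁ (subst (λ β → C (odd i) β ≡ true) (odd-moved b≢ j) (cls i _ e))
  horizontal : ∀ {a} → a ≢ still → c (step a i) j ≡ true → RookClass
  horizontal a≢ e = inj₂ (subst (λ α → C α (odd j) ≡ true) (odd-moved a≢ i) (cls _ j e))
  class-of : ∀ {s} → (shift s c i j ≡ true → RookClass) → shift s c i j ≡ true → RookClass
  class-of f = f
  rook : RookClass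
  rook = lookupWith (λ {s} → class-of {s})
           (vertical {down} (λ ()) ∷ vertical {up} (λ ()) ∷ horizontal {up} (λ ()) ∷ horizontal {down} (λ ()) ∷ [])
           (nbhdXor-any orthogonal c i j (trans (sym (C2-is-orthogonal c i j)) (cong parity one)))
  off : ∀ {a b} → a ≢ still → b ≢ still → c (step a i) (step b j) ≡ false
  off a≢ b≢ = outside-class {C} cls _ _
    (subst₂ (λ α β → C α β ≡ false) (sym (odd-moved a≢ i)) (sym (odd-moved b≢ j)) (excludes (odd i) (odd j) rook))

C2-orbit-lone-rook : ∀ k i j → sumP (orbit C2 k) i j ≡ 1 → sumX (orbit C2 k) i j ≡ 0
C2-orbit-lone-rook k with C2-orbit.orbit-class k
... | inj₁ cls = no-diagonal-beside-lone-rook {evenCells} evenCells-rook-diagonal cls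
... | inj₂ cls = no-diagonal-beside-lone-rook {mixedCells} mixedCells-rook-diagonal cls

-- The rules C3 and C3′ along the C2 orbit

bit≤1 : ∀ a → b2n a ≤ 1
bit≤1 true  = ≤-refl
bit≤1 false = z≤n

sumP≤4 : ∀ c i j → sumP c i j ≤ 4
sumP≤4 c i j = +-mono-≤ (+-mono-≤ (+-mono-≤ (bit≤1 (c i (step down j))) (bit≤1 (c i (step up j))))
                                  (bit≤1 (c (step up i) j))) (bit≤1 (c (step down i) j))

≡ᵇ1-agrees-with-parity : ∀ n → n ≤ 4 → n ≢ 3 → (n ℕ.≡ᵇ 1) ≡ parity n
≡ᵇ1-agrees-with-parity 0 _ _ = refl
≡ᵇ1-agrees-with-parity 1 _ _ = refl
≡ᵇ1-agrees-with-parity 2 _ _ = refl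
≡ᵇ1-agrees-with-parity 3 _ n≢3 with () ← n≢3 refl
≡ᵇ1-agrees-with-parity 4 _ _ = refl
≡ᵇ1-agrees-with-parity (suc (suc (suc (suc (suc n))))) (s≤s (s≤s (s≤s (s≤s ())))) _

C3′-test≡C3-test : ∀ n x → (n ≡ 1 → x ≡ 0) → (if n ℕ.≡ᵇ 1 then x ℕ.≡ᵇ 0 else false) ≡ (n ℕ.≡ᵇ 1)
C3′-test≡C3-test 0             x _ = refl
C3′-test≡C3-test 1             x h rewrite h refl = refl
C3′-test≡C3-test (suc (suc n)) x _ = refl

C3-on-C2-orbit : ∀ k → applyRule C3 (orbit C2 k) ≐ applyRule C2 (orbit C2 k)
C3-on-C2-orbit k i j = ≡ᵇ1-agrees-with-parity (sumP (orbit C2 k) i j) (sumP≤4 (orbit C2 k) i j) (C2-orbit-no-three k i j)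

C3′-on-C2-orbit : ∀ k → applyRule C3' (orbit C2 k) ≐ applyRule C2 (orbit C2 k)
C3′-on-C2-orbit k i j = trans (C3′-test≡C3-test (sumP (orbit C2 k) i j) (sumX (orbit C2 k) i j) (C2-orbit-lone-rook k i j))
                              (C3-on-C2-orbit k i j)

orbit-follows-C2 : ∀ r → (∀ k → applyRule r (orbit C2 k) ≐ applyRule C2 (orbit C2 k)) →
                   ∀ k → orbit r k ≐ orbit C2 k
orbit-follows-C2 r agree k = proj₁ (both k)
  where
  both : ∀ k → orbit r k ≐ orbit C2 k × orbit r (suc k) ≐ orbit C2 (suc k)
  both zero    = (λ _ _ → refl) , (λ _ _ → refl)
  both (suc k) = proj₂ (both k)
               , λ i j → cong₂ _xor_ (trans (applyRule-cong r (proj₂ (both k)) i j) (agree (suc k) i j))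
                                     (proj₁ (both k) i j)

linear-along-C2-orbit : ∀ r → (∀ k → applyRule r (orbit C2 k) ≐ applyRule C2 (orbit C2 k)) →
                        ∀ k → applyRule r (orbit r k) ≐ nbhdXor orthogonal (orbit r k)
linear-along-C2-orbit r agree k = begin
  applyRule r (orbit r k)             ≈⟨ applyRule-cong r (orbit-follows-C2 r agree k) ⟩
  applyRule r (orbit C2 k)            ≈⟨ agree k ⟩
  applyRule C2 (orbit C2 k)           ≈⟨ C2-is-orthogonal (orbit C2 k) ⟩
  nbhdXor orthogonal (orbit C2 k)     ≈⟨ nbhdXor-cong orthogonal (≐-sym (orbit-follows-C2 r agree k)) ⟩
  nbhdXor orthogonal (orbit r k)      ∎
  where open SetoidReasoning ≐-setoid

mainTheorem5 : (r : Rule) (n : ℕ) →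
    (R₁ r (2 * n + 1) ≡ 4 * R₁ r n) ×
    (R₁ r (2 * n + 2) ≡ R₁ r n + R₁ r (n + 1)) ×
    (R₂ r (2 * n) ≡ 4 * R₂ r n) ×
    (R₂ r (2 * n + 1) ≡ R₂ r n + R₂ r (n + 1))
mainTheorem5 C1  = DiagonalDoubling.Orbit.laws C1 (λ k → C1-is-diagonal (orbit C1 k))
mainTheorem5 C2  = C2-orbit.laws
mainTheorem5 C3  = OrthogonalDoubling.Orbit.laws C3 (linear-along-C2-orbit C3 C3-on-C2-orbit)
mainTheorem5 C3' = OrthogonalDoubling.Orbit.laws C3' (linear-along-C2-orbit C3' C3′-on-C2-orbit)
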